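{- Let $\mathcal{G}$ be a finite connected simple $r$-regular graph with a proper edge coloring $c:E\to R$, $|R|=r$, and let $\mathcal{P}_{\mathcal{G}}$ be its colorful polytope. Then the automorphism group $\Gamma(\mathcal{P}_{\mathcal{G}})$ of $\mathcal{P}_{\mathcal{G}}$ equals $\Gamma_c(\mathcal{G})$, the group of color respecting automorphisms of $\mathcal{G}$; precisely, restriction to the $1$-skeleton (identified with $\mathcal{G}$) is an isomorphism from $\Gamma(\mathcal{P}_{\mathcal{G}})$ onto $\Gamma_c(\mathcal{G})$, with inverse sending $\gamma\in\Gamma_c(\mathcal{G})$ to the map $(C,v)\mapsto(\bar\gamma(C),\gamma(v))$, where $\bar\gamma$ is the permutation of $R$ induced by $\gamma$.
   Context: Each vertex of $\mathcal{G}$ lies on exactly one edge of each color. For $C\subseteq R$, $v\sim_C w$ means there is an edge path from $v$ to $w$ with all edge colors in $C$. The colorful polytope $\mathcal{P}_{\mathcal{G}}$ consists of a least face of rank $-1$ and faces $(C,v)$ ($C\subseteq R$, $v\in V$) of rank $|C|$, with $(C,v)=(D,w)$ iff $C=D$ and $v\sim_C w$, ordered by $(C,v)\le(D,w)$ iff $C\subseteq D$ and $v\sim_D w$; it is an abstract polytope of rank $r$ whose $1$-skeleton is identified with $\mathcal{G}$ via $v\leftrightarrow(\emptyset,v)$. An automorphism of a polytope is an order-preserving bijection of its faces. A graph automorphism $\gamma$ of $\mathcal{G}$ is color respecting if $c(e)=c(e')$ implies $c(\gamma(e))=c(\gamma(e'))$; it then induces a permutation $\bar\gamma$ of $R$ with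 $\bar\gamma(c(e))=c(\gamma(e))$. -}

module Defs where

open import Data.Nat using (ℕ)
open import Data.Bool using (Bool; true; false; _∧_)
open import Data.Fin using (Fin; _≟_)
open import Data.Fin.Subset using (Subset; _∈_; _⊆_; ∣_∣; ⊤; ⊥)
open import Data.Vec using (tabulate; lookup)
open import Data.List using (allFin)
open import Data.Bool.ListAction using (any)
open import Data.Product using (Σ; _×_; _,_)
open import Data.Empty using () renaming (⊥ to Empty)
open import Data.Unit using () renaming (⊤ to Unit)
open import Relation.Nullary.Decidable using (⌊_⌋)
open import Relation.Binary.PropositionalEquality using (_≡_)
open import Function.Bundles using (_⇔_)

data ReachIn {n r : ℕ} (Adj : Fin n → Fin n → Bool) (col : Fin n → Fin n → Fin r)
             (C : Subset r) (v : Fin n) : Fin n → Set where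
  here : ReachIn Adj col C v v
  step : ∀ {w u} → ReachIn Adj col C v w → Adj w u ≡ true → col w u ∈ C →
         ReachIn Adj col C v u

-- Adjacency is a symmetric irreflexive Bool-valued relation; the colour of an
-- edge {v,w} is col v w (values of col on non-edges are irrelevant).
record ColoredGraph (n r : ℕ) : Set where
  field
    Adj     : Fin n → Fin n → Bool
    col     : Fin n → Fin n → Fin r

  Edge : Fin n → Fin n → Set
  Edge v w = Adj v w ≡ true

  neighbours : Fin n → Subset n
  neighbours v = tabulate (Adj v)

  Reach : Subset r → Fin n → Fin n → Set
  Reach = ReachIn Adj col

  field
    Adj-sym     : ∀ v w → Adj v w ≡ Adj w v
    Adj-irrefl  : ∀ v → Adj v v ≡ false
    col-sym     : ∀ v w → Edge v w → col v w ≡ col w v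
    regular     : ∀ v → ∣ neighbours v ∣ ≡ r
    proper      : ∀ v w w′ → Edge v w → Edge v w′ → col v w ≡ col v w′ → w ≡ w′
    connected   : ∀ v w → Reach ⊤ v w

module _ {n r : ℕ} (G : ColoredGraph n r) where
  open ColoredGraph G

  -- faces of the colorful polytope: the least face, and (C , v)
  data Face : Set where
    bot  : Face
    face : Subset r → Fin n → Face

  _≈F_ : Face → Face → Set
  bot ≈F bot = Unit
  bot ≈F face _ _ = Empty
  face _ _ ≈F bot = Empty
  face C v ≈F face D w = (C ≡ D) × Reach C v w

  _≤F_ : Face → Face → Set
  bot ≤F _ = Unit
  face _ _ ≤F bot = Empty
  face C v ≤F face D w = (C ⊆ D) × Reach D v w

  IsPolytopeAut : (Face → Face) → Set
  IsPolytopeAut f =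
    (∀ x y → x ≈F y → f x ≈F f y) ×
    (∀ x y → (x ≤F y) ⇔ (f x ≤F f y)) ×
    Σ (Face → Face) (λ g → (∀ x y → x ≈F y → g x ≈F g y) ×
                           (∀ x → g (f x) ≈F x) × (∀ x → f (g x) ≈F x))

  IsGraphAut : (Fin n → Fin n) → Set
  IsGraphAut γ =
    Σ (Fin n → Fin n) (λ δ → (∀ v → δ (γ v) ≡ v) × (∀ v → γ (δ v) ≡ v)) ×
    (∀ v w → Adj (γ v) (γ w) ≡ Adj v w)

  IsColorRespecting : (Fin n → Fin n) → Set
  IsColorRespecting γ =
    IsGraphAut γ ×
    (∀ v w v′ w′ → Edge v w → Edge v′ w′ → col v w ≡ col v′ w′ →
       col (γ v) (γ w) ≡ col (γ v′) (γ w′))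

  Induces : (Fin n → Fin n) → (Fin r → Fin r) → Set
  Induces γ π = ∀ v w → Edge v w → π (col v w) ≡ col (γ v) (γ w)

  IsPermutation : (Fin r → Fin r) → Set
  IsPermutation π = Σ (Fin r → Fin r) (λ ρ → (∀ i → ρ (π i) ≡ i) × (∀ i → π (ρ i) ≡ i))

  imageSub : (Fin r → Fin r) → Subset r → Subset r
  imageSub π C = tabulate (λ j → any (λ i → lookup C i ∧ ⌊ π i ≟ j ⌋) (allFin r))

  liftAut : (Fin n → Fin n) → (Fin r → Fin r) → Face → Face
  liftAut γ π bot = bot
  liftAut γ π (face C v) = face (imageSub π C) (γ v)

  vertex : Fin n → Face
  vertex v = face ⊥ v

-- An automorphism f of the polytope maps vertices to vertices, which gives a bijection γ of
-- the vertex set, and for each vertex v it maps the faces (C , v) through v onto the faces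
-- through γ v, which gives an order automorphism φ_v of the Boolean lattice of color sets.
-- Such an automorphism permutes the atoms, so φ_v is the image map of a permutation σ_v of
-- the colors. Across an edge v w of color i the maps φ_v and φ_w agree on every set
-- containing i; applied to the sets {i , k} this forces σ_v = σ_w, so by connectedness σ is
-- one global permutation, and γ maps every edge of color i to an edge of color σ i.
-- Since the graph is r-regular and properly colored, every color occurs at every vertex,
-- so σ is the permutation induced by γ.
-- Conversely a color respecting γ carries C-colored paths to π(C)-colored paths, so
-- (C , v) ↦ (π(C) , γ v) is well defined and monotone, with the lift of γ⁻¹ as inverse.
module Submission where

open import Defs
open import Data.Nat using (ℕ; zero; suc; _≤_; z≤n)
open import Data.Nat.Properties using (<-irrefl; module ≤-Reasoning)
open import Data.Bool using (Bool; true; false)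
open import Data.Bool.Properties using (T-≡; T-∧; ⇔→≡) renaming (_≟_ to _≟ᴮ_)
open import Data.Fin using (Fin; zero; suc; _≟_)
open import Data.Fin.Properties using (¬Fin0; any?; suc-injective; 0≢1+n)
open import Data.Fin.Subset using (Subset; _∈_; _⊆_; ∣_∣; ⊤; ⊥; ⁅_⁆; _∪_; _-_; Nonempty)
open import Data.Fin.Subset.Properties
  using (⊆-antisym; Empty-unique; nonempty?; ∉⊥; ⊥⊆; ∈⊤; ∣⊤∣≡n; x∈⁅x⁆; x∈⁅y⁆⇒x≡y;
         x∈p∪q⁺; x∈p∪q⁻; x∈p∧x∉q⇒x∈p─q; x∈p⇒∣p-x∣<∣p∣)
open import Data.Vec using (_∷_; []; tabulate; here; there)
open import Data.Vec.Properties using ([]=⇒lookup; lookup⇒[]=; lookup∘tabulate)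
open import Data.List using (allFin)
open import Data.List.Relation.Unary.Any using (satisfied)
open import Data.List.Relation.Unary.Any.Properties using (any⁺; any⁻)
open import Data.List.Membership.Propositional using (lose)
open import Data.List.Membership.Propositional.Properties using (∈-allFin)
open import Data.Product using (Σ; ∃-syntax; _×_; _,_; proj₁; proj₂)
open import Data.Sum using (_⊎_; inj₁; inj₂; [_,_]′)
open import Data.Empty using (⊥-elim)
open import Data.Unit using (tt)
open import Function using (_∘_; id)
open import Relation.Nullary using (¬_; yes; no)
open import Relation.Nullary.Decidable using (_×-dec_; toWitness; fromWitness)
open import Relation.Binary.PropositionalEquality
  using (_≡_; refl; sym; trans; cong; cong₂; subst; subst₂; module ≡-Reasoning)
open import Function.Bundles using (_⇔_; mk⇔; Equivalence)

∈-tabulate⁻ : ∀ {m} {h : Fin m → Bool} {j} → j ∈ tabulate h → h j ≡ true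
∈-tabulate⁻ {h = h} {j} j∈ = trans (sym (lookup∘tabulate h j)) ([]=⇒lookup j∈)

∈-tabulate⁺ : ∀ {m} {h : Fin m → Bool} {j} → h j ≡ true → j ∈ tabulate h
∈-tabulate⁺ {h = h} {j} hj = lookup⇒[]= j (tabulate h) (trans (lookup∘tabulate h j) hj)

x∈p⇒⁅x⁆⊆p : ∀ {m} {x : Fin m} {p} → x ∈ p → ⁅ x ⁆ ⊆ p
x∈p⇒⁅x⁆⊆p {x = x} {p} x∈p y∈⁅x⁆ = subst (_∈ p) (sym (x∈⁅y⁆⇒x≡y x y∈⁅x⁆)) x∈p

nonempty-⊆⁅x⁆⇒≡⁅x⁆ : ∀ {m} {x : Fin m} {p} → Nonempty p → p ⊆ ⁅ x ⁆ → p ≡ ⁅ x ⁆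
nonempty-⊆⁅x⁆⇒≡⁅x⁆ {x = x} (y , y∈p) p⊆⁅x⁆ =
  ⊆-antisym p⊆⁅x⁆ (x∈p⇒⁅x⁆⊆p (subst (_∈ _) (x∈⁅y⁆⇒x≡y x (p⊆⁅x⁆ y∈p)) y∈p))

nonempty-or-⊥ : ∀ {m} (p : Subset m) → Nonempty p ⊎ p ≡ ⊥
nonempty-or-⊥ p with nonempty? p
... | yes ne = inj₁ ne
... | no ¬ne = inj₂ (Empty-unique ¬ne)

injectiveOn⇒∣p∣≤∣q∣ : ∀ {n m} (p : Subset n) (q : Subset m) (h : Fin n → Fin m) →
  (∀ {u u′} → u ∈ p → u′ ∈ p → h u ≡ h u′ → u ≡ u′) →
  (∀ {u} → u ∈ p → h u ∈ q) → ∣ p ∣ ≤ ∣ q ∣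
injectiveOn⇒∣p∣≤∣q∣ [] q h inj into = z≤n
injectiveOn⇒∣p∣≤∣q∣ (false ∷ p) q h inj into =
  injectiveOn⇒∣p∣≤∣q∣ p q (h ∘ suc) (λ u∈ u′∈ → suc-injective ∘ inj (there u∈) (there u′∈)) (into ∘ there)
injectiveOn⇒∣p∣≤∣q∣ (true ∷ p) q h inj into = begin-strict
  ∣ p ∣         ≤⟨ injectiveOn⇒∣p∣≤∣q∣ p (q - h zero) (h ∘ suc)
                     (λ u∈ u′∈ → suc-injective ∘ inj (there u∈) (there u′∈)) into-rest ⟩
  ∣ q - h zero ∣ <⟨ x∈p⇒∣p-x∣<∣p∣ (into here) ⟩
  ∣ q ∣         ∎
  where
    open ≤-Reasoning
    into-rest : ∀ {u} → u ∈ p → h (suc u) ∈ q - h zero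
    into-rest u∈ = x∈p∧x∉q⇒x∈p─q (into (there u∈))
      (λ hit → 0≢1+n (inj here (there u∈) (sym (x∈⁅y⁆⇒x≡y _ hit))))

Fin-or-empty : ∀ n → Fin n ⊎ ¬ Fin n
Fin-or-empty zero = inj₂ ¬Fin0
Fin-or-empty (suc n) = inj₁ zero

module SubsetOrderAutomorphism {r : ℕ} (φ : Subset r → Subset r)
  (φ-mono : ∀ {C D} → C ⊆ D → φ C ⊆ φ D)
  (φ-reflects : ∀ {C D} → φ C ⊆ φ D → C ⊆ D)
  (φ-surjective : ∀ E → ∃[ C ] φ C ≡ E) where

  φ-⊥ : φ ⊥ ≡ ⊥
  φ-⊥ = let C , φC≡⊥ = φ-surjective ⊥ in
    ⊆-antisym (subst (φ ⊥ ⊆_) φC≡⊥ (φ-mono ⊥⊆)) ⊥⊆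

  φ≡⊥⇒≡⊥ : ∀ {C} → φ C ≡ ⊥ → C ≡ ⊥
  φ≡⊥⇒≡⊥ φC≡⊥ = ⊆-antisym (φ-reflects (subst (_⊆ φ ⊥) (sym φC≡⊥) ⊥⊆)) ⊥⊆

  nonempty-preimage : ∀ {C} → Nonempty (φ C) → Nonempty C
  nonempty-preimage {C} (j , j∈φC) with nonempty-or-⊥ C
  ... | inj₁ ne = ne
  ... | inj₂ refl = ⊥-elim (∉⊥ (subst (j ∈_) φ-⊥ j∈φC))

  atom-preimage : ∀ j → ∃[ D ] (φ D ≡ ⁅ j ⁆ × Nonempty D)
  atom-preimage j = let D , φD≡⁅j⁆ = φ-surjective ⁅ j ⁆ in
    D , φD≡⁅j⁆ , nonempty-preimage (j , subst (j ∈_) (sym φD≡⁅j⁆) (x∈⁅x⁆ j))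

  φ-atom : ∀ i → ∃[ j ] φ ⁅ i ⁆ ≡ ⁅ j ⁆
  φ-atom i with nonempty-or-⊥ (φ ⁅ i ⁆)
  ... | inj₂ φ⁅i⁆≡⊥ = ⊥-elim (∉⊥ (subst (i ∈_) (φ≡⊥⇒≡⊥ φ⁅i⁆≡⊥) (x∈⁅x⁆ i)))
  ... | inj₁ (j , j∈φ⁅i⁆) with atom-preimage j
  ...   | D , φD≡⁅j⁆ , D-nonempty = j , subst (λ E → φ E ≡ ⁅ j ⁆) D≡⁅i⁆ φD≡⁅j⁆
    where
      D≡⁅i⁆ : D ≡ ⁅ i ⁆
      D≡⁅i⁆ = nonempty-⊆⁅x⁆⇒≡⁅x⁆ D-nonempty
                (φ-reflects (subst (_⊆ φ ⁅ i ⁆) (sym φD≡⁅j⁆) (x∈p⇒⁅x⁆⊆p j∈φ⁅i⁆)))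

  σ : Fin r → Fin r
  σ i = proj₁ (φ-atom i)

  φ-⁅⁆ : ∀ i → φ ⁅ i ⁆ ≡ ⁅ σ i ⁆
  φ-⁅⁆ i = proj₂ (φ-atom i)

  σ∈φ⁅⁆ : ∀ i → σ i ∈ φ ⁅ i ⁆
  σ∈φ⁅⁆ i = subst (σ i ∈_) (sym (φ-⁅⁆ i)) (x∈⁅x⁆ (σ i))

  σ-injective : ∀ {i i′} → σ i ≡ σ i′ → i ≡ i′
  σ-injective {i} {i′} σi≡σi′ = x∈⁅y⁆⇒x≡y i′ (φ-reflects φ⁅i⁆⊆φ⁅i′⁆ (x∈⁅x⁆ i))
    where
      φ⁅i⁆⊆φ⁅i′⁆ : φ ⁅ i ⁆ ⊆ φ ⁅ i′ ⁆
      φ⁅i⁆⊆φ⁅i′⁆ = subst₂ _⊆_ (sym (φ-⁅⁆ i)) (trans (cong ⁅_⁆ σi≡σi′) (sym (φ-⁅⁆ i′))) id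

  ∈-φ⁺ : ∀ {C i} → i ∈ C → σ i ∈ φ C
  ∈-φ⁺ {i = i} i∈C = φ-mono (x∈p⇒⁅x⁆⊆p i∈C) (σ∈φ⁅⁆ i)

  ∈-φ⁻ : ∀ {C j} → j ∈ φ C → ∃[ i ] (i ∈ C × σ i ≡ j)
  ∈-φ⁻ {C} {j} j∈φC with atom-preimage j
  ... | D , φD≡⁅j⁆ , k , k∈D = k , D⊆C k∈D , x∈⁅y⁆⇒x≡y j σk∈⁅j⁆
    where
      D⊆C : D ⊆ C
      D⊆C = φ-reflects (subst (_⊆ φ C) (sym φD≡⁅j⁆) (x∈p⇒⁅x⁆⊆p j∈φC))
      σk∈⁅j⁆ : σ k ∈ ⁅ j ⁆
      σk∈⁅j⁆ = subst (σ k ∈_) φD≡⁅j⁆ (φ-mono (x∈p⇒⁅x⁆⊆p k∈D) (σ∈φ⁅⁆ k))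

module _ {n r : ℕ} (G : ColoredGraph n r) where
  open ColoredGraph G

  private
    _≈_ : Face G → Face G → Set
    _≈_ = _≈F_ G

    _≼_ : Face G → Face G → Set
    _≼_ = _≤F_ G

  Reach-trans : ∀ {C u v w} → Reach C u v → Reach C v w → Reach C u w
  Reach-trans p here = p
  Reach-trans p (step q e c) = step (Reach-trans p q) e c

  Reach-sym : ∀ {C u v} → Reach C u v → Reach C v u
  Reach-sym here = here
  Reach-sym {C} {u} {v} (step {w} p e c) = Reach-trans back (Reach-sym p)
    where
      back : Reach C v w
      back = step here (trans (Adj-sym v w) e) (subst (_∈ C) (col-sym w v e) c)

  Reach-mono : ∀ {C D u v} → C ⊆ D → Reach C u v → Reach D u v
  Reach-mono C⊆D here = here
  Reach-mono C⊆D (step p e c) = step (Reach-mono C⊆D p) e (C⊆D c)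

  Reach-⊥⇒≡ : ∀ {u v} → Reach ⊥ u v → u ≡ v
  Reach-⊥⇒≡ here = refl
  Reach-⊥⇒≡ (step _ _ c) = ⊥-elim (∉⊥ c)

  -- Properness: a second i-colored step from the neighbour can only lead back.
  Reach-⁅⁆ : ∀ {i u v} → Reach ⁅ i ⁆ u v → v ≡ u ⊎ (Edge u v × col u v ≡ i)
  Reach-⁅⁆ here = inj₁ refl
  Reach-⁅⁆ {i} (step p e c) with Reach-⁅⁆ p
  ... | inj₁ refl = inj₂ (e , x∈⁅y⁆⇒x≡y i c)
  ... | inj₂ (e′ , c′) = inj₁ (sym (proper _ _ _ (trans (Adj-sym _ _) e′) e
        (trans (sym (col-sym _ _ e′)) (trans c′ (sym (x∈⁅y⁆⇒x≡y i c))))))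

  no-loop : ∀ v → ¬ Edge v v
  no-loop v e with () ← trans (sym e) (Adj-irrefl v)

  ≈F-refl : ∀ {x} → x ≈ x
  ≈F-refl {bot} = tt
  ≈F-refl {face _ _} = refl , here

  ≈F-sym : ∀ {x y} → x ≈ y → y ≈ x
  ≈F-sym {bot} {bot} _ = tt
  ≈F-sym {face _ _} {face _ _} (refl , p) = refl , Reach-sym p

  ≈F-trans : ∀ {x y z} → x ≈ y → y ≈ z → x ≈ z
  ≈F-trans {bot} {bot} {bot} _ _ = tt
  ≈F-trans {face _ _} {face _ _} {face _ _} (refl , p) (refl , q) = refl , Reach-trans p q

  ≤F-resp-≈F : ∀ {x x′ y y′} → x ≈ x′ → y ≈ y′ → x ≼ y → x′ ≼ y′
  ≤F-resp-≈F {bot} {bot} _ _ _ = tt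
  ≤F-resp-≈F {face _ _} {face _ _} {face _ _} {face _ _} (refl , p) (refl , q) (C⊆D , t) =
    C⊆D , Reach-trans (Reach-trans (Reach-sym (Reach-mono C⊆D p)) t) q

  ≤F-bot : ∀ {x} → x ≼ bot → x ≈ bot
  ≤F-bot {bot} _ = tt

  ∈-neighbours⁻ : ∀ {v u} → u ∈ neighbours v → Edge v u
  ∈-neighbours⁻ = ∈-tabulate⁻

  edge-of-color : ∀ v i → ∃[ u ] (Edge v u × col v u ≡ i)
  edge-of-color v i with any? (λ u → (Adj v u ≟ᴮ true) ×-dec (col v u ≟ i))
  ... | yes found = found
  ... | no none = ⊥-elim (<-irrefl refl (begin-strict
    r                 ≡⟨ sym (regular v) ⟩
    ∣ neighbours v ∣  ≤⟨ injectiveOn⇒∣p∣≤∣q∣ (neighbours v) (⊤ - i) (col v) injective missing-i ⟩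
    ∣ ⊤ - i ∣         <⟨ x∈p⇒∣p-x∣<∣p∣ {p = ⊤ {r}} (∈⊤ {x = i}) ⟩
    ∣ ⊤ {r} ∣         ≡⟨ ∣⊤∣≡n r ⟩
    r                 ∎))
    where
      open ≤-Reasoning
      injective : ∀ {u u′} → u ∈ neighbours v → u′ ∈ neighbours v → col v u ≡ col v u′ → u ≡ u′
      injective u∈ u′∈ = proper v _ _ (∈-neighbours⁻ u∈) (∈-neighbours⁻ u′∈)
      missing-i : ∀ {u} → u ∈ neighbours v → col v u ∈ ⊤ - i
      missing-i u∈ = x∈p∧x∉q⇒x∈p─q ∈⊤ (λ hit → none (_ , ∈-neighbours⁻ u∈ , x∈⁅y⁆⇒x≡y i hit))

  ∈-imageSub⁺ : ∀ π {C i} → i ∈ C → π i ∈ imageSub G π C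
  ∈-imageSub⁺ π {C} {i} i∈C = ∈-tabulate⁺ (Equivalence.to T-≡
    (any⁺ _ (lose (∈-allFin i) (Equivalence.from T-∧
      (Equivalence.from T-≡ ([]=⇒lookup i∈C) , fromWitness refl)))))

  ∈-imageSub⁻ : ∀ π {C j} → j ∈ imageSub G π C → ∃[ i ] (i ∈ C × π i ≡ j)
  ∈-imageSub⁻ π {C} {j} j∈ with satisfied (any⁻ _ (allFin r) (Equivalence.from T-≡ (∈-tabulate⁻ j∈)))
  ... | i , hit with Equivalence.to T-∧ hit
  ...   | i∈C , πi≡j = i , lookup⇒[]= i C (Equivalence.to T-≡ i∈C) , toWitness πi≡j

  imageSub-mono : ∀ π {C D} → C ⊆ D → imageSub G π C ⊆ imageSub G π D
  imageSub-mono π C⊆D j∈ with ∈-imageSub⁻ π j∈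
  ... | i , i∈C , refl = ∈-imageSub⁺ π (C⊆D i∈C)

  imageSub-⊥ : ∀ π → imageSub G π ⊥ ≡ ⊥
  imageSub-⊥ π = Empty-unique λ (j , j∈) → ∉⊥ (proj₁ (proj₂ (∈-imageSub⁻ π j∈)))

  imageSub-inverse : ∀ {π ρ} → (∀ i → ρ (π i) ≡ i) → ∀ C → imageSub G ρ (imageSub G π C) ≡ C
  imageSub-inverse {π} {ρ} ρ∘π C = ⊆-antisym ⊆C C⊆
    where
      ⊆C : imageSub G ρ (imageSub G π C) ⊆ C
      ⊆C j∈ with ∈-imageSub⁻ ρ j∈
      ... | k , k∈ , refl with ∈-imageSub⁻ π k∈
      ...   | i , i∈C , refl = subst (_∈ C) (sym (ρ∘π i)) i∈C
      C⊆ : C ⊆ imageSub G ρ (imageSub G π C)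
      C⊆ {i} i∈C = subst (_∈ imageSub G ρ (imageSub G π C)) (ρ∘π i)
                     (∈-imageSub⁺ ρ (∈-imageSub⁺ π i∈C))

  IsEdgePreserving : (Fin n → Fin n) → Set
  IsEdgePreserving h = ∀ v w → Edge v w → Edge (h v) (h w)

  Reach-map : ∀ {h π} → IsEdgePreserving h → Induces G h π →
              ∀ {C u v} → Reach C u v → Reach (imageSub G π C) (h u) (h v)
  Reach-map h-edge h-col here = here
  Reach-map {π = π} h-edge h-col {C} (step {w} {u} p e c) =
    step (Reach-map h-edge h-col p) (h-edge w u e)
         (subst (_∈ imageSub G π C) (h-col w u e) (∈-imageSub⁺ π c))

  liftAut-resp-≈F : ∀ {h π} → IsEdgePreserving h → Induces G h π →
                    ∀ x y → x ≈ y → liftAut G h π x ≈ liftAut G h π y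
  liftAut-resp-≈F h-edge h-col bot bot _ = tt
  liftAut-resp-≈F h-edge h-col (face C v) (face D w) (refl , p) = refl , Reach-map h-edge h-col p

  liftAut-mono : ∀ {h π} → IsEdgePreserving h → Induces G h π →
                 ∀ x y → x ≼ y → liftAut G h π x ≼ liftAut G h π y
  liftAut-mono h-edge h-col bot _ _ = tt
  liftAut-mono {π = π} h-edge h-col (face C v) (face D w) (C⊆D , p) =
    imageSub-mono π C⊆D , Reach-map h-edge h-col p

  liftAut-inverse : ∀ {γ δ π ρ} → (∀ v → δ (γ v) ≡ v) → (∀ i → ρ (π i) ≡ i) →
                    ∀ x → liftAut G δ ρ (liftAut G γ π x) ≈ x
  liftAut-inverse δ∘γ ρ∘π bot = tt
  liftAut-inverse δ∘γ ρ∘π (face C v) = imageSub-inverse ρ∘π C , subst (λ u → Reach _ u v) (sym (δ∘γ v)) here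

  liftAut-vertex : ∀ γ π v → liftAut G γ π (vertex G v) ≈ vertex G (γ v)
  liftAut-vertex γ π v = imageSub-⊥ π , here

  Induces-inverse : ∀ {γ δ π ρ} → IsEdgePreserving δ → (∀ v → γ (δ v) ≡ v) →
                    (∀ i → ρ (π i) ≡ i) → Induces G γ π → Induces G δ ρ
  Induces-inverse {γ} {δ} {π} {ρ} δ-edge γ∘δ ρ∘π γ-col a b e = begin
    ρ (col a b)                   ≡⟨ cong (ρ ∘ col a) (sym (γ∘δ b)) ⟩
    ρ (col a (γ (δ b)))           ≡⟨ cong (λ u → ρ (col u (γ (δ b)))) (sym (γ∘δ a)) ⟩
    ρ (col (γ (δ a)) (γ (δ b)))   ≡⟨ cong ρ (sym (γ-col (δ a) (δ b) (δ-edge a b e))) ⟩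
    ρ (π (col (δ a) (δ b)))       ≡⟨ ρ∘π _ ⟩
    col (δ a) (δ b)               ∎
    where open ≡-Reasoning

  liftAut-isPolytopeAut : ∀ {γ δ π ρ} → IsEdgePreserving γ → IsEdgePreserving δ →
    (∀ v → δ (γ v) ≡ v) → (∀ v → γ (δ v) ≡ v) → (∀ i → ρ (π i) ≡ i) → (∀ i → π (ρ i) ≡ i) →
    Induces G γ π → IsPolytopeAut G (liftAut G γ π)
  liftAut-isPolytopeAut {γ} {δ} {π} {ρ} γ-edge δ-edge δ∘γ γ∘δ ρ∘π π∘ρ γ-col =
    liftAut-resp-≈F γ-edge γ-col ,
    (λ x y → mk⇔ (liftAut-mono γ-edge γ-col x y) (reflects x y)) ,
    liftAut G δ ρ , liftAut-resp-≈F δ-edge δ-col ,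
    γ⁻¹∘γ , liftAut-inverse γ∘δ π∘ρ
    where
      δ-col : Induces G δ ρ
      δ-col = Induces-inverse {π = π} {ρ = ρ} δ-edge γ∘δ ρ∘π γ-col
      γ⁻¹∘γ : ∀ x → liftAut G δ ρ (liftAut G γ π x) ≈ x
      γ⁻¹∘γ = liftAut-inverse δ∘γ ρ∘π
      reflects : ∀ x y → liftAut G γ π x ≼ liftAut G γ π y → x ≼ y
      reflects x y le = ≤F-resp-≈F (γ⁻¹∘γ x) (γ⁻¹∘γ y) (liftAut-mono δ-edge δ-col _ _ le)

  module NoVertices (no-vertex : ¬ Fin n) where
    only-bot : (x : Face G) → x ≡ bot
    only-bot bot = refl
    only-bot (face _ v) = ⊥-elim (no-vertex v)

    ≈F-all : (x y : Face G) → x ≈ y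
    ≈F-all x y rewrite only-bot x | only-bot y = tt

    ≤F-all : (x y : Face G) → x ≼ y
    ≤F-all x y rewrite only-bot x = tt

    isPolytopeAut : ∀ f → IsPolytopeAut G f
    isPolytopeAut f =
      (λ x y _ → ≈F-all (f x) (f y)) , (λ x y → mk⇔ (λ _ → ≤F-all _ _) (λ _ → ≤F-all _ _)) ,
      id , (λ x y _ → ≈F-all x y) , (λ x → ≈F-all _ x) , (λ x → ≈F-all _ x)

  module ColorRespecting {γ : Fin n → Fin n} (cr : IsColorRespecting G γ) where
    δ : Fin n → Fin n
    δ = proj₁ (proj₁ (proj₁ cr))

    δ∘γ : ∀ v → δ (γ v) ≡ v
    δ∘γ = proj₁ (proj₂ (proj₁ (proj₁ cr)))

    γ∘δ : ∀ v → γ (δ v) ≡ v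
    γ∘δ = proj₂ (proj₂ (proj₁ (proj₁ cr)))

    γ-Adj : ∀ v w → Adj (γ v) (γ w) ≡ Adj v w
    γ-Adj = proj₂ (proj₁ cr)

    γ-respects-colors : ∀ v w v′ w′ → Edge v w → Edge v′ w′ → col v w ≡ col v′ w′ →
                        col (γ v) (γ w) ≡ col (γ v′) (γ w′)
    γ-respects-colors = proj₂ cr

    γ-edge : IsEdgePreserving γ
    γ-edge v w e = trans (γ-Adj v w) e

    δ-edge : IsEdgePreserving δ
    δ-edge v w e = trans (sym (γ-Adj (δ v) (δ w))) (trans (cong₂ Adj (γ∘δ v) (γ∘δ w)) e)

    induced : Fin n → Fin r → Fin r
    induced v₀ i = col (γ v₀) (γ (proj₁ (edge-of-color v₀ i)))

    induced-Induces : ∀ v₀ → Induces G γ (induced v₀)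
    induced-Induces v₀ v w e with edge-of-color v₀ (col v w)
    ... | u , e₀ , c₀ = γ-respects-colors v₀ u v w e₀ e c₀

    Induces⇒IsPermutation : Fin n → ∀ {π} → Induces G γ π → IsPermutation G π
    Induces⇒IsPermutation v₀ {π} γ-col = ρ , ρ∘π , π∘ρ
      where
        ρ : Fin r → Fin r
        ρ j = col v₀ (δ (proj₁ (edge-of-color (γ v₀) j)))

        ρ∘π : ∀ i → ρ (π i) ≡ i
        ρ∘π i with edge-of-color v₀ i | edge-of-color (γ v₀) (π i)
        ... | u , e , refl | w , e′ , c′ = begin
          col v₀ (δ w)      ≡⟨ cong (col v₀ ∘ δ) w≡γu ⟩
          col v₀ (δ (γ u))  ≡⟨ cong (col v₀) (δ∘γ u) ⟩
          col v₀ u          ∎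
          where
            open ≡-Reasoning
            w≡γu : w ≡ γ u
            w≡γu = proper (γ v₀) w (γ u) e′ (γ-edge v₀ u e) (trans c′ (γ-col v₀ u e))

        π∘ρ : ∀ j → π (ρ j) ≡ j
        π∘ρ j with edge-of-color (γ v₀) j
        ... | w , e , c = begin
          π (col v₀ (δ w))          ≡⟨ γ-col v₀ (δ w) (subst (λ u → Edge u (δ w)) (δ∘γ v₀) (δ-edge _ _ e)) ⟩
          col (γ v₀) (γ (δ w))      ≡⟨ cong (col (γ v₀)) (γ∘δ w) ⟩
          col (γ v₀) w              ≡⟨ c ⟩
          j                         ∎
          where open ≡-Reasoning

    induced-permutation : ∃[ π ] (Induces G γ π × IsPermutation G π)
    induced-permutation with Fin-or-empty n
    ... | inj₁ v₀ = induced v₀ , induced-Induces v₀ , Induces⇒IsPermutation v₀ (induced-Induces v₀)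
    ... | inj₂ no-vertex = id , (λ v → ⊥-elim (no-vertex v)) , id , (λ _ → refl) , (λ _ → refl)

    lift-isPolytopeAut : ∀ π → Induces G γ π → IsPolytopeAut G (liftAut G γ π)
    lift-isPolytopeAut π γ-col with Fin-or-empty n
    ... | inj₁ v₀ = let ρ , ρ∘π , π∘ρ = Induces⇒IsPermutation v₀ {π} γ-col in
      liftAut-isPolytopeAut γ-edge δ-edge δ∘γ γ∘δ ρ∘π π∘ρ γ-col
    ... | inj₂ no-vertex = NoVertices.isPolytopeAut no-vertex _

  colorRespecting⇒polytopeAut : (γ : Fin n → Fin n) → IsColorRespecting G γ →
    Σ (Fin r → Fin r) (λ π → Induces G γ π × IsPermutation G π) ×
    (∀ π → Induces G γ π →
      IsPolytopeAut G (liftAut G γ π) × (∀ v → liftAut G γ π (vertex G v) ≈ vertex G (γ v)))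
  colorRespecting⇒polytopeAut γ cr =
    induced-permutation , λ π γ-col → lift-isPolytopeAut π γ-col , liftAut-vertex γ π
    where open ColorRespecting cr

  colorsOf : Face G → Subset r
  colorsOf bot = ⊥
  colorsOf (face C _) = C

  -- The least face has no vertex; the given default is returned for it.
  vertexOf : Fin n → Face G → Fin n
  vertexOf v bot = v
  vertexOf _ (face _ w) = w

  IsPolytopeAut-inverse : ∀ {f} (aut : IsPolytopeAut G f) → IsPolytopeAut G (proj₁ (proj₂ (proj₂ aut)))
  IsPolytopeAut-inverse {f} (f-resp , f-ord , g , g-resp , g∘f , f∘g) =
    g-resp , g-ord , f , f-resp , f∘g , g∘f
    where
      g-ord : ∀ x y → (x ≼ y) ⇔ (g x ≼ g y)
      g-ord x y = mk⇔
        (λ le → Equivalence.from (f-ord (g x) (g y)) (≤F-resp-≈F (≈F-sym (f∘g x)) (≈F-sym (f∘g y)) le))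
        (λ le → ≤F-resp-≈F (f∘g x) (f∘g y) (Equivalence.to (f-ord (g x) (g y)) le))

  module FromPolytopeAut {f : Face G → Face G} (aut : IsPolytopeAut G f) where
    f-resp : ∀ x y → x ≈ y → f x ≈ f y
    f-resp = proj₁ aut

    f-mono : ∀ {x y} → x ≼ y → f x ≼ f y
    f-mono {x} {y} = Equivalence.to (proj₁ (proj₂ aut) x y)

    f-reflects : ∀ {x y} → f x ≼ f y → x ≼ y
    f-reflects {x} {y} = Equivalence.from (proj₁ (proj₂ aut) x y)

    f-surjective : ∀ x → ∃[ y ] f y ≈ x
    f-surjective x = proj₁ (proj₂ (proj₂ aut)) x , proj₂ (proj₂ (proj₂ (proj₂ (proj₂ aut)))) x

    f-bot : f bot ≈ bot
    f-bot = let y , fy≈bot = f-surjective bot in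
      ≤F-bot (≤F-resp-≈F ≈F-refl fy≈bot (f-mono {bot} {y} tt))

    f-surjective-face : ∀ E w → ∃[ C ] ∃[ u ] f (face C u) ≈ face E w
    f-surjective-face E w with f-surjective (face E w)
    ... | bot , fbot≈ = ⊥-elim (≈F-trans (≈F-sym f-bot) fbot≈)
    ... | face C u , fCu≈ = C , u , fCu≈

    φ : Fin n → Subset r → Subset r
    φ v C = colorsOf (f (face C v))

    γ : Fin n → Fin n
    γ v = vertexOf v (f (vertex G v))

    f-face≡ : ∀ C v → f (face C v) ≡ face (φ v C) (vertexOf v (f (face C v)))
    f-face≡ C v with f (face C v) in eq
    ... | face D w = refl
    ... | bot = ⊥-elim (f-reflects {face C v} {bot} (subst (_≼ f bot) (sym eq) tt))

    f-face : ∀ C v → f (face C v) ≈ face (φ v C) (γ v)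
    f-face C v = subst (_≈ face (φ v C) (γ v)) (sym (f-face≡ C v)) (refl , Reach-sym (proj₂ ≤C))
      where
        ≤C : face (φ v ⊥) (γ v) ≼ face (φ v C) (vertexOf v (f (face C v)))
        ≤C = subst₂ _≼_ (f-face≡ ⊥ v) (f-face≡ C v) (f-mono {face ⊥ v} {face C v} (⊥⊆ , here))

    face-mono : ∀ {C v D w} → face C v ≼ face D w → face (φ v C) (γ v) ≼ face (φ w D) (γ w)
    face-mono {C} {v} {D} {w} le =
      ≤F-resp-≈F (f-face C v) (f-face D w) (f-mono {face C v} {face D w} le)

    face-reflects : ∀ {C v D w} → face (φ v C) (γ v) ≼ face (φ w D) (γ w) → face C v ≼ face D w
    face-reflects {C} {v} {D} {w} le =
      f-reflects {face C v} {face D w} (≤F-resp-≈F (≈F-sym (f-face C v)) (≈F-sym (f-face D w)) le)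

    φ-≡ : ∀ {C v E w} → f (face C v) ≈ face E w → φ v C ≡ E
    φ-≡ {C} {v} h = proj₁ (≈F-trans (≈F-sym (f-face C v)) h)

    φ-⊥ : ∀ v → φ v ⊥ ≡ ⊥
    φ-⊥ v with f-surjective-face ⊥ (γ v)
    ... | C , u , fCu≈ = φ-≡ (≈F-trans (f-resp (face ⊥ v) (face C u) (sym C≡⊥ , Reach-sym (proj₂ Cu≤v))) fCu≈)
      where
        Cu≤v : face C u ≼ face ⊥ v
        Cu≤v = face-reflects (≤F-resp-≈F (≈F-trans (≈F-sym fCu≈) (f-face C u)) ≈F-refl (⊥⊆ , here))
        C≡⊥ : C ≡ ⊥
        C≡⊥ = ⊆-antisym (proj₁ Cu≤v) ⊥⊆

    f-vertex : ∀ v → f (vertex G v) ≈ vertex G (γ v)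
    f-vertex v = subst (λ E → f (vertex G v) ≈ face E (γ v)) (φ-⊥ v) (f-face ⊥ v)

    f-vertex⁻ : ∀ {v u} → f (vertex G v) ≈ vertex G u → γ v ≡ u
    f-vertex⁻ {v} h = Reach-⊥⇒≡ (proj₂ (≈F-trans (≈F-sym (f-vertex v)) h))

    γ-injective : ∀ {v w} → γ v ≡ γ w → v ≡ w
    γ-injective {v} {w} γv≡γw = Reach-⊥⇒≡ (proj₂ (face-reflects {⊥} {v} {⊥} {w} (⊆⊥ , reach)))
      where
        ⊆⊥ : φ v ⊥ ⊆ φ w ⊥
        ⊆⊥ = subst₂ _⊆_ (sym (φ-⊥ v)) (sym (φ-⊥ w)) id
        reach : Reach (φ w ⊥) (γ v) (γ w)
        reach = subst (Reach (φ w ⊥) (γ v)) γv≡γw here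

    φ-surjective : ∀ v E → ∃[ C ] φ v C ≡ E
    φ-surjective v E with f-surjective-face E (γ v)
    ... | C , u , fCu≈ = C , φ-≡ (≈F-trans (f-resp (face C v) (face C u) (refl , proj₂ v≤Cu)) fCu≈)
      where
        v≤Cu : vertex G v ≼ face C u
        v≤Cu = f-reflects {vertex G v} {face C u}
                 (≤F-resp-≈F (≈F-sym (f-vertex v)) (≈F-sym fCu≈) (⊥⊆ , here))

    φ-mono : ∀ v {C D} → C ⊆ D → φ v C ⊆ φ v D
    φ-mono v C⊆D = proj₁ (face-mono (C⊆D , here))

    φ-reflects : ∀ v {C D} → φ v C ⊆ φ v D → C ⊆ D
    φ-reflects v φC⊆φD = proj₁ (face-reflects (φC⊆φD , here))

    module Atoms (v : Fin n) = SubsetOrderAutomorphism (φ v) (φ-mono v) (φ-reflects v) (φ-surjective v)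

    σ : Fin n → Fin r → Fin r
    σ = Atoms.σ

    φ-edge : ∀ {v w C} → Edge v w → col v w ∈ C → φ v C ≡ φ w C
    φ-edge {v} {w} {C} e c = φ-≡ (≈F-trans (f-resp (face C v) (face C w) (refl , step here e c)) (f-face C w))

    σ-edge : ∀ {v w} → Edge v w → σ v (col v w) ≡ σ w (col v w)
    σ-edge {v} {w} e = x∈⁅y⁆⇒x≡y _ (subst (σ v (col v w) ∈_)
      (trans (φ-edge e (x∈⁅x⁆ _)) (Atoms.φ-⁅⁆ w (col v w))) (Atoms.σ∈φ⁅⁆ v (col v w)))

    σ∈φ-edge-pair : ∀ {v w} → Edge v w → ∀ k → σ v k ∈ φ w (⁅ col v w ⁆ ∪ ⁅ k ⁆)
    σ∈φ-edge-pair e k = subst (σ _ k ∈_) (φ-edge e (x∈p∪q⁺ (inj₁ (x∈⁅x⁆ _))))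
                          (Atoms.∈-φ⁺ _ (x∈p∪q⁺ (inj₂ (x∈⁅x⁆ k))))

    σ-agree-on-edge-pair : ∀ {v w k m} → Edge v w → σ w m ≡ σ v k →
                           m ∈ ⁅ col v w ⁆ ⊎ m ∈ ⁅ k ⁆ → σ v k ≡ σ w k
    σ-agree-on-edge-pair {v} {w} {k} e σwm≡σvk (inj₂ m∈⁅k⁆) =
      trans (sym σwm≡σvk) (cong (σ w) (x∈⁅y⁆⇒x≡y k m∈⁅k⁆))
    σ-agree-on-edge-pair {v} {w} {k} {m} e σwm≡σvk (inj₁ m∈⁅i⁆) =
      subst (λ c → σ v c ≡ σ w c) (sym k≡i) (σ-edge e)
      where
        k≡i : k ≡ col v w
        k≡i = Atoms.σ-injective v (sym (begin
          σ v (col v w)  ≡⟨ σ-edge e ⟩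
          σ w (col v w)  ≡⟨ cong (σ w) (sym (x∈⁅y⁆⇒x≡y _ m∈⁅i⁆)) ⟩
          σ w m          ≡⟨ σwm≡σvk ⟩
          σ v k          ∎))
          where open ≡-Reasoning

    σ-edge-invariant : ∀ {v w} → Edge v w → ∀ k → σ v k ≡ σ w k
    σ-edge-invariant {v} {w} e k =
      let m , m∈ , σwm≡σvk = Atoms.∈-φ⁻ w (σ∈φ-edge-pair e k) in
      σ-agree-on-edge-pair e σwm≡σvk (x∈p∪q⁻ ⁅ col v w ⁆ ⁅ k ⁆ m∈)

    σ-constant : ∀ {v w} → Reach ⊤ v w → ∀ k → σ v k ≡ σ w k
    σ-constant here k = refl
    σ-constant (step p e _) k = trans (σ-constant p k) (σ-edge-invariant e k)

    γ-edge-reach : ∀ {v w} → Edge v w → Reach ⁅ σ v (col v w) ⁆ (γ v) (γ w)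
    γ-edge-reach {v} {w} e = subst (λ E → Reach E (γ v) (γ w)) (Atoms.φ-⁅⁆ v (col v w))
      (proj₂ (≈F-trans (≈F-sym (f-face _ v)) (≈F-trans (f-resp _ _ (refl , step here e (x∈⁅x⁆ _))) (f-face _ w))))

    γ-edge : ∀ {v w} → Edge v w → Edge (γ v) (γ w) × col (γ v) (γ w) ≡ σ v (col v w)
    γ-edge {v} {w} e = [ (λ γw≡γv → ⊥-elim (no-loop v (subst (Edge v) (γ-injective γw≡γv) e))) , id ]′
                         (Reach-⁅⁆ (γ-edge-reach e))

    Induces⇒≡σ : ∀ {π} → Induces G γ π → ∀ v i → π i ≡ σ v i
    Induces⇒≡σ γ-col v i with edge-of-color v i
    ... | u , e , refl = trans (γ-col v u e) (proj₂ (γ-edge e))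

    φ≡imageSub : ∀ {π} → Induces G γ π → ∀ v C → φ v C ≡ imageSub G π C
    φ≡imageSub {π} γ-col v C = ⊆-antisym φ⊆ ⊆φ
      where
        φ⊆ : φ v C ⊆ imageSub G π C
        φ⊆ j∈ = let i , i∈C , σvi≡j = Atoms.∈-φ⁻ v j∈ in
          subst (_∈ imageSub G π C) (trans (Induces⇒≡σ {π} γ-col v i) σvi≡j) (∈-imageSub⁺ π i∈C)
        ⊆φ : imageSub G π C ⊆ φ v C
        ⊆φ j∈ with ∈-imageSub⁻ π j∈
        ... | i , i∈C , refl = subst (_∈ φ v C) (sym (Induces⇒≡σ γ-col v i)) (Atoms.∈-φ⁺ v i∈C)

    f≈liftAut : ∀ π → Induces G γ π → ∀ x → f x ≈ liftAut G γ π x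
    f≈liftAut π γ-col bot = f-bot
    f≈liftAut π γ-col (face C v) = ≈F-trans (f-face C v) (φ≡imageSub γ-col v C , here)

  polytopeAut⇒colorRespecting : (f : Face G → Face G) → IsPolytopeAut G f →
    Σ (Fin n → Fin n) (λ γ → IsColorRespecting G γ ×
      (∀ v → f (vertex G v) ≈ vertex G (γ v)) ×
      (∀ π → Induces G γ π → ∀ x → f x ≈ liftAut G γ π x))
  polytopeAut⇒colorRespecting f aut@(_ , _ , g , _ , g∘f , f∘g) =
    A.γ , (((B.γ , δ∘γ , γ∘δ) , γ-Adj) , γ-col) , A.f-vertex , A.f≈liftAut
    where
      module A = FromPolytopeAut aut
      module B = FromPolytopeAut (IsPolytopeAut-inverse aut)
      δ∘γ : ∀ v → B.γ (A.γ v) ≡ v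
      δ∘γ v = B.f-vertex⁻ (≈F-trans (B.f-resp _ _ (≈F-sym (A.f-vertex v))) (g∘f (vertex G v)))
      γ∘δ : ∀ v → A.γ (B.γ v) ≡ v
      γ∘δ v = A.f-vertex⁻ (≈F-trans (A.f-resp _ _ (≈F-sym (B.f-vertex v))) (f∘g (vertex G v)))
      γ-Adj : ∀ v w → Adj (A.γ v) (A.γ w) ≡ Adj v w
      γ-Adj v w = ⇔→≡ (mk⇔ (λ e → subst₂ Edge (δ∘γ v) (δ∘γ w) (proj₁ (B.γ-edge e)))
                           (λ e → proj₁ (A.γ-edge e)))
      γ-col : ∀ v w v′ w′ → Edge v w → Edge v′ w′ → col v w ≡ col v′ w′ →
              col (A.γ v) (A.γ w) ≡ col (A.γ v′) (A.γ w′)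
      γ-col v w v′ w′ e e′ c = begin
        col (A.γ v) (A.γ w)    ≡⟨ proj₂ (A.γ-edge e) ⟩
        A.σ v (col v w)        ≡⟨ cong (A.σ v) c ⟩
        A.σ v (col v′ w′)      ≡⟨ A.σ-constant (connected v v′) _ ⟩
        A.σ v′ (col v′ w′)     ≡⟨ sym (proj₂ (A.γ-edge e′)) ⟩
        col (A.γ v′) (A.γ w′)  ∎
        where open ≡-Reasoning

mainTheorem3 : ∀ {n r} (G : ColoredGraph n r) →
    ((f : Face G → Face G) → IsPolytopeAut G f →
      Σ (Fin n → Fin n) (λ γ → IsColorRespecting G γ ×
        (∀ v → _≈F_ G (f (vertex G v)) (vertex G (γ v))) ×
        (∀ π → Induces G γ π → ∀ x → _≈F_ G (f x) (liftAut G γ π x)))) ×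
    ((γ : Fin n → Fin n) → IsColorRespecting G γ →
      Σ (Fin r → Fin r) (λ π → Induces G γ π × IsPermutation G π) ×
      (∀ π → Induces G γ π →
        IsPolytopeAut G (liftAut G γ π) ×
        (∀ v → _≈F_ G (liftAut G γ π (vertex G v)) (vertex G (γ v)))))
mainTheorem3 G = polytopeAut⇒colorRespecting G , colorRespecting⇒polytopeAut G
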